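{- Let $k\geq 2$ and $n\geq k$, and write $n=km+r$ with $m\geq 1$ and $r\in\{0,\dots,k-1\}$. Define \[S_n=\bigcup_{ab\in\partial\mathcal{F}_{m+1}(\mathbf{t}^{(k)})}\mathcal{F}_{r+k}\big(\sigma_k(ab)\big),\qquad G_n=\bigcup_{ab\in\partial\mathcal{F}_{m+2}(\mathbf{t}^{(k)})}\mathcal{F}_{r}\big(\sigma_k(ab)[k-r+2,\,k+r-1]\big).\] If $r\leq 1$, then $\rho_n^{ab}(\mathbf{t}^{(k)})=\#\{\psi(u):u\in S_n\}$. If $r\geq 2$, then \[\rho_n^{ab}(\mathbf{t}^{(k)})=\#\Big(\{\psi(u):u\in S_n\}\cup\{\mathbb{I}_k+\psi(v):v\in G_n\}\Big),\] where $\mathbb{I}_k=(1,1,\dots,1)$ is the all-ones vector of length $k$.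
   Context: Let $\Sigma_k=\{0,\dots,k-1\}$, let $\sigma_k$ be the morphism $\sigma_k(i)=i(i+1)\cdots(i+k-1)$ (letters mod $k$), and $\mathbf{t}^{(k)}=\sigma_k^\infty(0)$ its fixed point starting with $0$. For a word $v$, $\psi(v)=(|v|_0,\dots,|v|_{k-1})$ is its Parikh vector. For a finite or infinite word $\mathbf{x}$, $\mathcal{F}_n(\mathbf{x})$ is the set of its factors of length $n$. For $u=u_0\cdots u_{n-1}$ with $n\geq 2$, $\partial u=u_0u_{n-1}$ and $\partial\mathcal{F}_n(\mathbf{x})=\{\partial u:u\in\mathcal{F}_n(\mathbf{x})\}$. For a finite word $u=u_0\cdots u_{N-1}$, $u[i,j]=u_{i-1}u_i\cdots u_{j-1}$ (the letters in positions $i$ through $j$, counting from $1$). The abelian complexity is $\rho_n^{ab}(\mathbf{x})=\#\{\psi(v):v\in\mathcal{F}_n(\mathbf{x})\}$. -}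

module Defs where

open import Data.Nat using (ℕ; zero; suc; _+_; _*_; _∸_; _≤_; _<_; NonZero)
open import Data.Nat.DivMod using (_%_)
open import Data.List using (List; []; _∷_; map; concatMap; upTo; length; take; drop; filter; zipWith; replicate; _++_; applyUpTo)
open import Data.List.Membership.Propositional using (_∈_)
open import Data.List.Relation.Unary.Unique.Propositional using (Unique)
open import Data.Maybe using (fromMaybe)
open import Data.List using (lookup)
open import Data.Product using (Σ; ∃; _×_; _,_)
open import Function.Bundles using (_⇔_)
open import Relation.Binary.PropositionalEquality using (_≡_)
open import Data.Nat using (_≟_)
open import Data.Sum using (_⊎_)

-- Words are lists of natural numbers; letters of Σ_k are 0, …, k-1.
Word : Set
Word = List ℕ

σ : (k : ℕ) → .{{_ : NonZero k}} → ℕ → Word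
σ k i = map (λ j → (i + j) % k) (upTo k)

σ* : (k : ℕ) → .{{_ : NonZero k}} → Word → Word
σ* k = concatMap (σ k)

iter : ℕ → (Word → Word) → Word → Word
iter zero f w = w
iter (suc j) f w = f (iter j f w)

-- letter at position i of a finite word (default 0 if out of range)
at : Word → ℕ → ℕ
at [] i = 0
at (x ∷ w) zero = x
at (x ∷ w) (suc i) = at w i

-- t^(k) = σ_k^∞(0): the i-th letter is the i-th letter of σ_k^(i+1)(0),
-- which has length k^(i+1) > i for k ≥ 2 (a prefix of the fixed point).
t : (k : ℕ) → .{{_ : NonZero k}} → ℕ → ℕ
t k i = at (iter (suc i) (σ* k) (0 ∷ [])) i

factorAt : (ℕ → ℕ) → ℕ → ℕ → Word
factorAt x i n = applyUpTo (λ j → x (i + j)) n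

InFactorsInf : (ℕ → ℕ) → ℕ → Word → Set
InFactorsInf x n u = ∃ λ i → u ≡ factorAt x i n

InFactors : Word → ℕ → Word → Set
InFactors w n u = ∃ λ i → (i + n ≤ length w) × (u ≡ take n (drop i w))

-- w[i,j] : letters in positions i through j (counting from 1)
slice : ℕ → ℕ → Word → Word
slice i j w = take (suc j ∸ i) (drop (i ∸ 1) w)

ψ : ℕ → Word → List ℕ
ψ k v = map (λ a → length (filter (λ b → b ≟ a) v)) (upTo k)

𝕀 : ℕ → List ℕ
𝕀 k = replicate k 1

_⊕_ : List ℕ → List ℕ → List ℕ
_⊕_ = zipWith _+_

HasCard : (List ℕ → Set) → ℕ → Set
HasCard P c = Σ (List (List ℕ)) λ Ls →
  Unique Ls × (∀ x → (x ∈ Ls) ⇔ P x) × (length Ls ≡ c)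

AbVecs : (k : ℕ) → .{{_ : NonZero k}} → ℕ → List ℕ → Set
AbVecs k n p = ∃ λ v → InFactorsInf (t k) n v × ψ k v ≡ p

-- u ∈ S_n = ⋃_{ab ∈ ∂F_{m+1}(t)} F_{r+k}(σ_k(ab))
-- (ab ∈ ∂F_{m+1}(t) iff ab = t_i t_{i+m} for some i)
InS : (k : ℕ) → .{{_ : NonZero k}} → ℕ → ℕ → Word → Set
InS k m r u = ∃ λ i → InFactors (σ* k (t k i ∷ t k (i + m) ∷ [])) (r + k) u

InG : (k : ℕ) → .{{_ : NonZero k}} → ℕ → ℕ → Word → Set
InG k m r v = ∃ λ i →
  InFactors (slice (k ∸ r + 2) (k + r ∸ 1) (σ* k (t k i ∷ t k (i + suc m) ∷ []))) r v

PsiS : (k : ℕ) → .{{_ : NonZero k}} → ℕ → ℕ → List ℕ → Set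
PsiS k m r p = ∃ λ u → InS k m r u × ψ k u ≡ p

PsiSG : (k : ℕ) → .{{_ : NonZero k}} → ℕ → ℕ → List ℕ → Set
PsiSG k m r p = PsiS k m r p ⊎ (∃ λ v → InG k m r v × (𝕀 k ⊕ ψ k v) ≡ p)

module Submission where

-- Since t = σ_k(t), the letter of t at k q + l (l < k) is t_q + l mod k: t is the concatenation of the blocks
-- σ_k(t_q). A factor of length n = k m + r starting at k q + s (s < k) thus consists of the last k - s letters of
-- σ_k(t_q), a run of complete blocks, each containing every letter once, and a prefix of a later block. If s + r ≤ k
-- there are m - 1 complete blocks and the two partial blocks form the factor of length r + k of σ_k(t_q t_{q+m})
-- starting at s, an element of S_n; otherwise there are m complete blocks and the partial blocks form the factor of
-- length r of σ_k(t_q t_{q+m+1}) straddling its middle, an element of G_n. So the Parikh vectors of F_n(t) are those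
-- of S_n (and 𝕀_k + those of G_n) translated by (m - 1)𝕀_k. Both unions range over all pairs of letters, since every
-- pair occurs in t at every distance d ≥ 1; this makes the sets finite and the translation carries the count over.

open import Data.List
  using (List; []; _∷_; [_]; _++_; _∷ʳ_; map; concatMap; upTo; applyUpTo; length; take; drop; filter; deduplicate)
open import Data.List.Properties
  using (≡-dec; length-++; filter-++; filter-accept; filter-reject; applyUpTo-∷ʳ; upTo-∷ʳ; map-upTo; map-cong; map-id-local; length-map; length-upTo; length-take; take-take; drop-drop; length-applyUpTo; ++-identityʳ; map-injective; map-applyUpTo; concatMap-++; ++-assoc; length-drop)
open import Data.List.Membership.Propositional using (_∈_; find; lose)
open import Data.List.Membership.Propositional.Properties
  using (∈-map⁺; ∈-map⁻; ∈-filter⁺; ∈-filter⁻; ∈-upTo⁺; ∈-upTo⁻; ∈-concatMap⁺; ∈-concatMap⁻; ∈-++⁺ˡ; ∈-++⁺ʳ; ∈-++⁻; ∈-deduplicate⁺; ∈-deduplicate⁻)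
open import Data.List.Relation.Unary.All.Properties using (applyUpTo⁺₁)
open import Data.List.Relation.Unary.Unique.DecPropositional.Properties using (deduplicate-!)
import Data.List.Relation.Unary.Unique.Propositional.Properties as Unique
open import Data.Nat
  using (ℕ; zero; suc; _+_; _*_; _∸_; _^_; _≤_; _<_; NonZero; z≤n; s≤s; s≤s⁻¹; s<s⁻¹; z<s; s<s; _≟_; _≤?_)
open import Data.Nat.Properties
open import Data.Nat.DivMod
open import Algebra.Properties.CommutativeSemigroup +-commutativeSemigroup using (x∙yz≈y∙xz)
open import Data.Nat.Induction using (<-rec)
open import Data.Nat.Tactic.RingSolver using (solve-∀)
open import Data.Product using (∃; ∃₂; _×_; _,_; proj₂)
open import Data.Sum using (_⊎_; inj₁; inj₂)
import Data.Sum as Sum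
open import Function.Base using (_∘_)
open import Function.Bundles using (_⇔_; mk⇔; Equivalence)
open import Relation.Binary.PropositionalEquality hiding ([_])
open import Relation.Nullary using (yes; no; contradiction)

open import Defs

open ≡-Reasoning

m+m≡m*2 : ∀ m → m + m ≡ m * 2
m+m≡m*2 m = trans (cong (m +_) (sym (*-identityʳ m))) (sym (*-suc m 1))

k*[m/k]+m%k≡m : ∀ m k .{{_ : NonZero k}} → k * (m / k) + m % k ≡ m
k*[m/k]+m%k≡m m k = trans (trans (+-comm (k * (m / k)) (m % k)) (cong (m % k +_) (*-comm k (m / k))))
  (sym (m≡m%n+[m/n]*n m k))

[m%n+o]%n≡[m+o]%n : ∀ m o n .{{_ : NonZero n}} → (m % n + o) % n ≡ (m + o) % n
[m%n+o]%n≡[m+o]%n m o n = begin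
  (m % n + o) % n            ≡⟨ %-distribˡ-+ (m % n) o n ⟩
  (m % n % n + o % n) % n    ≡⟨ cong (λ x → (x + o % n) % n) (m%n%n≡m%n m n) ⟩
  (m % n + o % n) % n        ≡⟨ %-distribˡ-+ m o n ⟨
  (m + o) % n                ∎

[[m+[n∸o]]%n+o]%n≡m : ∀ {m n o} .{{_ : NonZero n}} → o ≤ n → m < n → ((m + (n ∸ o)) % n + o) % n ≡ m
[[m+[n∸o]]%n+o]%n≡m {m} {n} {o} o≤n m<n = begin
  ((m + (n ∸ o)) % n + o) % n    ≡⟨ [m%n+o]%n≡[m+o]%n (m + (n ∸ o)) o n ⟩
  (m + (n ∸ o) + o) % n          ≡⟨ cong (_% n) (trans (+-assoc m (n ∸ o) o) (cong (m +_) (m∸n+n≡m o≤n))) ⟩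
  (m + n) % n                    ≡⟨ [m+n]%n≡m%n m n ⟩
  m % n                          ≡⟨ m<n⇒m%n≡m m<n ⟩
  m                              ∎

[n∸m]+[m+o]≡n+o : ∀ {m n} o → m ≤ n → (n ∸ m) + (m + o) ≡ n + o
[n∸m]+[m+o]≡n+o {m} {n} o m≤n = trans (sym (+-assoc (n ∸ m) m o)) (cong (_+ o) (m∸n+n≡m m≤n))

[n∸m]+[m+o∸n]≡o : ∀ {m n o} → m ≤ n → n ≤ m + o → (n ∸ m) + (m + o ∸ n) ≡ o
[n∸m]+[m+o∸n]≡o {m} {n} {o} m≤n n≤m+o = +-cancelˡ-≡ m _ _ (begin
  m + ((n ∸ m) + (m + o ∸ n))   ≡⟨ +-assoc m (n ∸ m) _ ⟨
  m + (n ∸ m) + (m + o ∸ n)     ≡⟨ cong (_+ (m + o ∸ n)) (m+[n∸m]≡n m≤n) ⟩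
  n + (m + o ∸ n)               ≡⟨ m+[n∸m]≡n n≤m+o ⟩
  m + o                         ∎)

count : ℕ → Word → ℕ
count a w = length (filter (_≟ a) w)

count-++ : ∀ a u v → count a (u ++ v) ≡ count a u + count a v
count-++ a u v = trans (cong length (filter-++ (_≟ a) u v)) (length-++ (filter (_≟ a) u))

count-++-comm : ∀ a u v → count a (u ++ v) ≡ count a (v ++ u)
count-++-comm a u v = begin
  count a (u ++ v)          ≡⟨ count-++ a u v ⟩
  count a u + count a v     ≡⟨ +-comm (count a u) _ ⟩
  count a v + count a u     ≡⟨ count-++ a v u ⟨
  count a (v ++ u)          ∎

count-[x]-≢ : ∀ {a x} → x ≢ a → count a [ x ] ≡ 0
count-[x]-≢ x≢a = cong length (filter-reject (_≟ _) x≢a)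

count-upTo-≤ : ∀ {a} n → n ≤ a → count a (upTo n) ≡ 0
count-upTo-≤ zero _ = refl
count-upTo-≤ {a} (suc n) n<a = begin
  count a (upTo (suc n))            ≡⟨ cong (count a) (upTo-∷ʳ n) ⟨
  count a (upTo n ∷ʳ n)             ≡⟨ count-++ a (upTo n) [ n ] ⟩
  count a (upTo n) + count a [ n ]  ≡⟨ cong₂ _+_ (count-upTo-≤ n (<⇒≤ n<a)) (count-[x]-≢ (<⇒≢ n<a)) ⟩
  0                                 ∎

count-upTo : ∀ {a} n → a < n → count a (upTo n) ≡ 1
count-upTo {a} (suc n) a<1+n = begin
  count a (upTo (suc n))            ≡⟨ cong (count a) (upTo-∷ʳ n) ⟨
  count a (upTo n ∷ʳ n)             ≡⟨ count-++ a (upTo n) [ n ] ⟩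
  count a (upTo n) + count a [ n ]  ≡⟨ last (m≤n⇒m<n∨m≡n (s≤s⁻¹ a<1+n)) ⟩
  1                                 ∎
  where
  last : a < n ⊎ a ≡ n → count a (upTo n) + count a [ n ] ≡ 1
  last (inj₁ a<n)  = cong₂ _+_ (count-upTo n a<n) (count-[x]-≢ (>⇒≢ a<n))
  last (inj₂ refl) = cong₂ _+_ (count-upTo-≤ n ≤-refl) (cong length (filter-accept (_≟ a) refl))

count-rotate : ∀ a (g : ℕ → ℕ) n → g n ≡ g 0 →
  count a (applyUpTo (g ∘ suc) n) ≡ count a (applyUpTo g n)
count-rotate a g zero _ = refl
count-rotate a g (suc n) gn≡g0 = begin
  count a (applyUpTo (g ∘ suc) (suc n))           ≡⟨ cong (count a) (applyUpTo-∷ʳ (g ∘ suc) n) ⟨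
  count a (applyUpTo (g ∘ suc) n ∷ʳ g (suc n))    ≡⟨ count-++-comm a (applyUpTo (g ∘ suc) n) _ ⟩
  count a (g (suc n) ∷ applyUpTo (g ∘ suc) n)     ≡⟨ cong (λ x → count a (x ∷ applyUpTo (g ∘ suc) n)) gn≡g0 ⟩
  count a (applyUpTo g (suc n))                   ∎

at-applyUpTo : ∀ (f : ℕ → ℕ) {n i} → i < n → at (applyUpTo f n) i ≡ f i
at-applyUpTo f {suc n} {zero}  _   = refl
at-applyUpTo f {suc n} {suc i} i<n = at-applyUpTo (f ∘ suc) (s<s⁻¹ i<n)

at-++ˡ : ∀ (u v : Word) {i} → i < length u → at (u ++ v) i ≡ at u i
at-++ˡ (x ∷ u) v {zero}  _   = refl
at-++ˡ (x ∷ u) v {suc i} i<n = at-++ˡ u v (s<s⁻¹ i<n)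

at-++ʳ : ∀ (u v : Word) i → at (u ++ v) (length u + i) ≡ at v i
at-++ʳ []      v i = refl
at-++ʳ (x ∷ u) v i = at-++ʳ u v i

take-drop-at : ∀ (w : Word) i n → i + n ≤ length w →
  take n (drop i w) ≡ applyUpTo (λ j → at w (i + j)) n
take-drop-at w       i       zero    _   = refl
take-drop-at (x ∷ w) zero    (suc n) i+n≤ = cong (x ∷_) (take-drop-at w 0 n (s≤s⁻¹ i+n≤))
take-drop-at (x ∷ w) (suc i) (suc n) i+n≤ = take-drop-at w i (suc n) (s≤s⁻¹ i+n≤)

applyUpTo-cong-< : ∀ {f g : ℕ → ℕ} n → (∀ {j} → j < n → f j ≡ g j) →
  applyUpTo f n ≡ applyUpTo g n
applyUpTo-cong-< zero    f≡g = refl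
applyUpTo-cong-< (suc n) f≡g = cong₂ _∷_ (f≡g z<s) (applyUpTo-cong-< n (f≡g ∘ s<s))

applyUpTo-++ : ∀ (f : ℕ → ℕ) m n →
  applyUpTo f (m + n) ≡ applyUpTo f m ++ applyUpTo (λ j → f (m + j)) n
applyUpTo-++ f zero    n = refl
applyUpTo-++ f (suc m) n = cong (f 0 ∷_) (applyUpTo-++ (f ∘ suc) m n)

factorAt-++ : ∀ x i m n → factorAt x i (m + n) ≡ factorAt x i m ++ factorAt x (i + m) n
factorAt-++ x i m n = trans (applyUpTo-++ (λ j → x (i + j)) m n)
  (cong (factorAt x i m ++_) (applyUpTo-cong-< n (λ {j} _ → cong x (sym (+-assoc i m j)))))

factorAt-suc : ∀ x i n → factorAt x i (suc n) ≡ x i ∷ factorAt x (suc i) n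
factorAt-suc x i n = cong₂ _∷_ (cong x (+-identityʳ i)) (applyUpTo-cong-< n (λ {j} _ → cong x (+-suc i j)))

take-drop-take : ∀ {j r} ℓ (w : Word) → j + r ≤ ℓ → take r (drop j (take ℓ w)) ≡ take r (drop j w)
take-drop-take {zero}  {r} ℓ       w       r≤ℓ = trans (take-take r ℓ w) (cong (λ n → take n w) (m≤n⇒m⊓n≡m r≤ℓ))
take-drop-take {suc j}     (suc ℓ) []      _   = refl
take-drop-take {suc j}     (suc ℓ) (x ∷ w) j+r≤ = take-drop-take ℓ w (s≤s⁻¹ j+r≤)

factors : Word → ℕ → List Word
factors w n = map (λ i → take n (drop i w)) (filter (λ i → i + n ≤? length w) (upTo (suc (length w))))

∈-factors⇔ : ∀ w n u → u ∈ factors w n ⇔ InFactors w n u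
∈-factors⇔ w n u = mk⇔ to from
  where
  to : u ∈ factors w n → InFactors w n u
  to u∈ with i , i∈ , refl ← ∈-map⁻ _ u∈ = i , proj₂ (∈-filter⁻ (λ i → i + n ≤? length w) {xs = upTo _} i∈) , refl
  from : InFactors w n u → u ∈ factors w n
  from (i , i+n≤ , refl) = ∈-map⁺ _ (∈-filter⁺ (λ i → i + n ≤? length w) (∈-upTo⁺ (s≤s (≤-trans (m≤m+n i n) i+n≤))) i+n≤)

overPairs : ∀ {A : Set} → ℕ → (ℕ → ℕ → List A) → List A
overPairs k f = concatMap (λ a → concatMap (f a) (upTo k)) (upTo k)

∈-overPairs⇔ : ∀ {A : Set} k (f : ℕ → ℕ → List A) x →
  x ∈ overPairs k f ⇔ (∃₂ λ a b → a < k × b < k × x ∈ f a b)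
∈-overPairs⇔ k f x = mk⇔ to from
  where
  to : x ∈ overPairs k f → ∃₂ λ a b → a < k × b < k × x ∈ f a b
  to x∈ with a , a∈ , x∈ ← find (∈-concatMap⁻ _ x∈) with b , b∈ , x∈ ← find (∈-concatMap⁻ _ x∈) =
    a , b , ∈-upTo⁻ a∈ , ∈-upTo⁻ b∈ , x∈
  from : (∃₂ λ a b → a < k × b < k × x ∈ f a b) → x ∈ overPairs k f
  from (a , b , a<k , b<k , x∈) = ∈-concatMap⁺ _ (lose (∈-upTo⁺ a<k) (∈-concatMap⁺ _ (lose (∈-upTo⁺ b<k) x∈)))

∈-++⇔⊎ : ∀ {A : Set} {P Q : A → Set} xs ys → (∀ x → x ∈ xs ⇔ P x) → (∀ x → x ∈ ys ⇔ Q x) →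
  ∀ x → x ∈ xs ++ ys ⇔ (P x ⊎ Q x)
∈-++⇔⊎ xs ys xs⇔P ys⇔Q x = mk⇔
  (Sum.map (Equivalence.to (xs⇔P x)) (Equivalence.to (ys⇔Q x)) ∘ ∈-++⁻ xs)
  Sum.[ ∈-++⁺ˡ ∘ Equivalence.from (xs⇔P x) , ∈-++⁺ʳ xs ∘ Equivalence.from (ys⇔Q x) ]

HasCard-deduplicate : ∀ {P : List ℕ → Set} (L : List (List ℕ)) → (∀ x → x ∈ L ⇔ P x) →
  HasCard P (length (deduplicate (≡-dec _≟_) L))
HasCard-deduplicate L L⇔P = deduplicate (≡-dec _≟_) L , deduplicate-! (≡-dec _≟_) L ,
  (λ x → mk⇔ (Equivalence.to (L⇔P x) ∘ ∈-deduplicate⁻ (≡-dec _≟_) L)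
             (∈-deduplicate⁺ (≡-dec _≟_) ∘ Equivalence.from (L⇔P x))) ,
  refl

HasCard-image : ∀ {P Q : List ℕ → Set} {c} (f : List ℕ → List ℕ) → (∀ {x y} → f x ≡ f y → x ≡ y) →
  (∀ x → P x ⇔ (∃ λ y → Q y × x ≡ f y)) → HasCard Q c → HasCard P c
HasCard-image {P} {Q} f f-inj P⇔ (L , L-unique , L⇔Q , |L|≡c) =
  map f L , Unique.map⁺ f-inj L-unique , (λ x → mk⇔ (to x) (from x)) , trans (length-map f L) |L|≡c
  where
  to : ∀ x → x ∈ map f L → P x
  to x x∈ with y , y∈ , x≡fy ← ∈-map⁻ f x∈ = Equivalence.from (P⇔ x) (y , Equivalence.to (L⇔Q y) y∈ , x≡fy)
  from : ∀ x → P x → x ∈ map f L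
  from x Px with y , Qy , refl ← Equivalence.to (P⇔ x) Px = ∈-map⁺ f (Equivalence.from (L⇔Q y) Qy)

InFactors-slice⇔ : ∀ {i j n} (w : Word) v → i ≤ j → j ≤ length w →
  InFactors (slice (suc i) j w) n v ⇔ (∃ λ s → i ≤ s × s + n ≤ j × v ≡ take n (drop s w))
InFactors-slice⇔ {i} {j} {n} w v i≤j j≤|w| = mk⇔ to from
  where
  i+[j∸i]≡j : i + (j ∸ i) ≡ j
  i+[j∸i]≡j = m+[n∸m]≡n i≤j
  length-slice : length (take (j ∸ i) (drop i w)) ≡ j ∸ i
  length-slice = trans (length-take (j ∸ i) (drop i w))
    (m≤n⇒m⊓n≡m (≤-trans (∸-monoˡ-≤ i j≤|w|) (≤-reflexive (sym (length-drop i w)))))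
  take-drop-slice : ∀ {l} → l + n ≤ j ∸ i → take n (drop l (take (j ∸ i) (drop i w))) ≡ take n (drop (i + l) w)
  take-drop-slice {l} l+n≤ = trans (take-drop-take (j ∸ i) (drop i w) l+n≤) (cong (take n) (drop-drop i l w))
  to : InFactors (slice (suc i) j w) n v → ∃ λ s → i ≤ s × s + n ≤ j × v ≡ take n (drop s w)
  to (l , l+n≤ , v≡) = i + l , m≤m+n i l ,
    ≤-trans (≤-reflexive (+-assoc i l n)) (≤-trans (+-monoʳ-≤ i l+n≤′) (≤-reflexive i+[j∸i]≡j)) ,
    trans v≡ (take-drop-slice l+n≤′)
    where
    l+n≤′ : l + n ≤ j ∸ i
    l+n≤′ = subst (l + n ≤_) length-slice l+n≤
  from : (∃ λ s → i ≤ s × s + n ≤ j × v ≡ take n (drop s w)) → InFactors (slice (suc i) j w) n v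
  from (s , i≤s , s+n≤j , v≡) = s ∸ i , subst (s ∸ i + n ≤_) (sym length-slice) l+n≤ ,
    trans v≡ (sym (trans (take-drop-slice l+n≤) (cong (λ x → take n (drop x w)) (m+[n∸m]≡n i≤s))))
    where
    l+n≤ : s ∸ i + n ≤ j ∸ i
    l+n≤ = ≤-trans (≤-reflexive (sym (+-∸-comm n i≤s))) (∸-monoˡ-≤ i s+n≤j)

straddles⇔ : ∀ {k r s} → 1 ≤ r → r ≤ k → (k ∸ r + 1 ≤ s × s + r ≤ k + r ∸ 1) ⇔ (s < k × k < s + r)
straddles⇔ {k} {suc r} {s} (s≤s z≤n) r≤k = mk⇔
  (λ (start≤s , s+r≤end) → +-cancelʳ-≤ r (suc s) k (subst (suc s + r ≤_) end≡ (≤-trans (≤-reflexive (sym (+-suc s r))) s+r≤end)) ,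
                             subst (_≤ s + suc r) start+r≡ (+-monoˡ-≤ (suc r) start≤s))
  (λ (s<k , k<s+r) → +-cancelʳ-≤ (suc r) (k ∸ suc r + 1) s (subst (_≤ s + suc r) (sym start+r≡) k<s+r) ,
                      subst (s + suc r ≤_) (sym end≡) (≤-trans (≤-reflexive (+-suc s r)) (+-monoˡ-≤ r s<k)))
  where
  start+r≡ : k ∸ suc r + 1 + suc r ≡ suc k
  start+r≡ = trans (+-assoc (k ∸ suc r) 1 (suc r)) (trans (+-suc (k ∸ suc r) (suc r)) (cong suc (m∸n+n≡m r≤k)))
  end≡ : k + suc r ∸ 1 ≡ k + r
  end≡ = +-∸-assoc k (s≤s z≤n)

InFactors-straddle⇔ : ∀ {k r} (w : Word) v → 2 ≤ r → r < k → length w ≡ k * 2 →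
  InFactors (slice (k ∸ r + 2) (k + r ∸ 1) w) r v ⇔ (∃ λ s → s < k × k < s + r × v ≡ take r (drop s w))
InFactors-straddle⇔ {k} {r} w v 2≤r r<k |w|≡ = mk⇔
  (λ inF → let (s , start≤s , s+r≤end , v≡) = Equivalence.to slice⇔ (subst in-slice start≡ inF)
               (s<k , k<s+r) = Equivalence.to (straddles⇔ 1≤r (<⇒≤ r<k)) (start≤s , s+r≤end)
           in s , s<k , k<s+r , v≡)
  (λ (s , s<k , k<s+r , v≡) → let (start≤s , s+r≤end) = Equivalence.from (straddles⇔ 1≤r (<⇒≤ r<k)) (s<k , k<s+r)
           in subst in-slice (sym start≡) (Equivalence.from slice⇔ (s , start≤s , s+r≤end , v≡)))
  where
  1≤r : 1 ≤ r
  1≤r = ≤-trans (s≤s z≤n) 2≤r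
  in-slice : ℕ → Set
  in-slice i = InFactors (slice i (k + r ∸ 1) w) r v
  start≡ : k ∸ r + 2 ≡ suc (k ∸ r + 1)
  start≡ = +-suc (k ∸ r) 1
  start≤end : k ∸ r + 1 ≤ k + r ∸ 1
  start≤end = ≤-trans (+-monoʳ-≤ (k ∸ r) 1≤r) (≤-trans (≤-reflexive (m∸n+n≡m (<⇒≤ r<k)))
    (≤-trans (m≤m+n k (r ∸ 1)) (≤-reflexive (sym (+-∸-assoc k 1≤r)))))
  end≤|w| : k + r ∸ 1 ≤ length w
  end≤|w| = ≤-trans (m∸n≤m (k + r) 1) (≤-trans (+-monoʳ-≤ k (<⇒≤ r<k)) (≤-reflexive (trans (m+m≡m*2 k) (sym |w|≡))))
  slice⇔ : InFactors (slice (suc (k ∸ r + 1)) (k + r ∸ 1) w) r v ⇔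
    (∃ λ s → k ∸ r + 1 ≤ s × s + r ≤ k + r ∸ 1 × v ≡ take r (drop s w))
  slice⇔ = InFactors-slice⇔ w v start≤end end≤|w|

ψ-pointwise : ∀ k w (f : ℕ → ℕ) → (∀ {a} → a < k → count a w ≡ f a) → ψ k w ≡ applyUpTo f k
ψ-pointwise k w f count≡f = trans (map-upTo (λ a → count a w) k) (applyUpTo-cong-< k count≡f)

ψ-shift : ∀ k c u v → (∀ {a} → a < k → count a u ≡ c + count a v) → ψ k u ≡ map (c +_) (ψ k v)
ψ-shift k c u v count≡ = begin
  ψ k u                                        ≡⟨ ψ-pointwise k u _ count≡ ⟩
  applyUpTo (λ a → c + count a v) k            ≡⟨ map-applyUpTo _ (c +_) k ⟨
  map (c +_) (applyUpTo (λ a → count a v) k)   ≡⟨ cong (map (c +_)) (map-upTo _ k) ⟨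
  map (c +_) (ψ k v)                           ∎

𝕀⊕applyUpTo : ∀ n (f : ℕ → ℕ) → 𝕀 n ⊕ applyUpTo f n ≡ applyUpTo (suc ∘ f) n
𝕀⊕applyUpTo zero    f = refl
𝕀⊕applyUpTo (suc n) f = cong (suc (f 0) ∷_) (𝕀⊕applyUpTo n (f ∘ suc))

ψ-shift-𝕀 : ∀ k c u v → (∀ {a} → a < k → count a u ≡ c + suc (count a v)) →
  ψ k u ≡ map (c +_) (𝕀 k ⊕ ψ k v)
ψ-shift-𝕀 k c u v count≡ = begin
  ψ k u                                              ≡⟨ ψ-pointwise k u _ count≡ ⟩
  applyUpTo (λ a → c + suc (count a v)) k            ≡⟨ map-applyUpTo _ (c +_) k ⟨
  map (c +_) (applyUpTo (λ a → suc (count a v)) k)   ≡⟨ cong (map (c +_)) (𝕀⊕applyUpTo k _) ⟨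
  map (c +_) (𝕀 k ⊕ applyUpTo (λ a → count a v) k)   ≡⟨ cong (λ p → map (c +_) (𝕀 k ⊕ p)) (map-upTo _ k) ⟨
  map (c +_) (𝕀 k ⊕ ψ k v)                           ∎

module _ (k : ℕ) .{{_ : NonZero k}} where

  length-σ : ∀ x → length (σ k x) ≡ k
  length-σ x = trans (length-map _ (upTo k)) (length-upTo k)

  length-σ* : ∀ w → length (σ* k w) ≡ k * length w
  length-σ* []      = sym (*-zeroʳ k)
  length-σ* (x ∷ w) = begin
    length (σ k x ++ σ* k w)            ≡⟨ length-++ (σ k x) ⟩
    length (σ k x) + length (σ* k w)    ≡⟨ cong₂ _+_ (length-σ x) (length-σ* w) ⟩
    k + k * length w                    ≡⟨ *-suc k (length w) ⟨
    k * suc (length w)                  ∎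

  at-σ : ∀ x {l} → l < k → at (σ k x) l ≡ (x + l) % k
  at-σ x l<k = trans (cong (λ w → at w _) (map-upTo _ k)) (at-applyUpTo _ l<k)

  at-σ* : ∀ w {q l} → q < length w → l < k → at (σ* k w) (k * q + l) ≡ (at w q + l) % k
  at-σ* (x ∷ w) {zero} {l} _ l<k = begin
    at (σ k x ++ σ* k w) (k * 0 + l)   ≡⟨ cong (λ i → at (σ k x ++ σ* k w) (i + l)) (*-zeroʳ k) ⟩
    at (σ k x ++ σ* k w) l             ≡⟨ at-++ˡ (σ k x) _ (subst (l <_) (sym (length-σ x)) l<k) ⟩
    at (σ k x) l                       ≡⟨ at-σ x l<k ⟩
    (x + l) % k                        ∎
  at-σ* (x ∷ w) {suc q} {l} q<n l<k = begin
    at (σ k x ++ σ* k w) (k * suc q + l)                  ≡⟨ cong (at (σ k x ++ σ* k w)) index ⟩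
    at (σ k x ++ σ* k w) (length (σ k x) + (k * q + l))   ≡⟨ at-++ʳ (σ k x) _ _ ⟩
    at (σ* k w) (k * q + l)                               ≡⟨ at-σ* w (s<s⁻¹ q<n) l<k ⟩
    (at w q + l) % k                                      ∎
    where
    index : k * suc q + l ≡ length (σ k x) + (k * q + l)
    index = trans (cong (_+ l) (*-suc k q)) (trans (+-assoc k (k * q) l) (cong (_+ (k * q + l)) (sym (length-σ x))))

  count-σ : ∀ x {a} → a < k → count a (σ k x) ≡ 1
  count-σ zero {a} a<k =
    trans (cong (count a) (map-id-local (applyUpTo⁺₁ (λ j → j) k m<n⇒m%n≡m))) (count-upTo k a<k)
  count-σ (suc x) {a} a<k = begin
    count a (σ k (suc x))             ≡⟨ cong (count a) σ[1+x]≡ ⟩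
    count a (applyUpTo (g ∘ suc) k)   ≡⟨ count-rotate a g k g-periodic ⟩
    count a (applyUpTo g k)           ≡⟨ cong (count a) (map-upTo g k) ⟨
    count a (σ k x)                   ≡⟨ count-σ x a<k ⟩
    1                                 ∎
    where
    g : ℕ → ℕ
    g j = (x + j) % k
    σ[1+x]≡ : σ k (suc x) ≡ applyUpTo (g ∘ suc) k
    σ[1+x]≡ = trans (map-cong (λ j → cong (_% k) (sym (+-suc x j))) (upTo k)) (map-upTo (g ∘ suc) k)
    g-periodic : g k ≡ g 0
    g-periodic = trans ([m+n]%n≡m%n x k) (cong (_% k) (sym (+-identityʳ x)))

  count-σ* : ∀ w {a} → a < k → count a (σ* k w) ≡ length w
  count-σ* []      a<k = refl
  count-σ* (x ∷ w) {a} a<k =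
    trans (count-++ a (σ k x) (σ* k w)) (cong₂ _+_ (count-σ x a<k) (count-σ* w a<k))

  window : ℕ → ℕ → Word
  window a b = σ* k (a ∷ b ∷ [])

  length-window : ∀ a b → length (window a b) ≡ k * 2
  length-window a b = length-σ* (a ∷ b ∷ [])

  at-window-left : ∀ a b {l} → l < k → at (window a b) l ≡ (a + l) % k
  at-window-left a b {l} l<k =
    trans (cong (λ i → at (window a b) (i + l)) (sym (*-zeroʳ k))) (at-σ* (a ∷ b ∷ []) z<s l<k)

  at-window-right : ∀ a b {l} → l < k → at (window a b) (k + l) ≡ (b + l) % k
  at-window-right a b {l} l<k =
    trans (cong (λ i → at (window a b) (i + l)) (sym (*-identityʳ k))) (at-σ* (a ∷ b ∷ []) (s<s z<s) l<k)

PsiG : (k : ℕ) → .{{_ : NonZero k}} → ℕ → ℕ → List ℕ → Set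
PsiG k m r p = ∃ λ v → InG k m r v × (𝕀 k ⊕ ψ k v) ≡ p

module _ (k : ℕ) .{{_ : NonZero k}} (k≥2 : 2 ≤ k) where

  0<k : 0 < k
  0<k = <-≤-trans z<s k≥2

  n<k^n : ∀ n → n < k ^ n
  n<k^n zero    = z<s
  n<k^n (suc n) = ≤-trans (+-mono-≤ (<-≤-trans z<s (n<k^n n)) (n<k^n n))
    (≤-trans (≤-reflexive (cong (k ^ n +_) (sym (+-identityʳ (k ^ n))))) (*-monoˡ-≤ (k ^ n) k≥2))

  σ*ⁿ : ℕ → Word
  σ*ⁿ j = iter j (σ* k) (0 ∷ [])

  length-σ*ⁿ : ∀ j → length (σ*ⁿ j) ≡ k ^ j
  length-σ*ⁿ zero    = refl
  length-σ*ⁿ (suc j) = trans (length-σ* k (σ*ⁿ j)) (cong (k *_) (length-σ*ⁿ j))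

  t-zero : t k 0 ≡ 0
  t-zero = trans (cong (λ i → at (σ*ⁿ 1) (i + 0)) (sym (*-zeroʳ k)))
    (trans (at-σ* k (0 ∷ []) z<s 0<k) (m<n⇒m%n≡m 0<k))

  σ*ⁿ-extends : ∀ j → ∃ λ X → σ*ⁿ (suc j) ≡ σ*ⁿ j ++ X
  σ*ⁿ-extends zero = drop 1 (σ*ⁿ 1) ,
    trans (head∷drop1 (σ*ⁿ 1) (subst (0 <_) (sym (trans (length-σ*ⁿ 1) (*-identityʳ k))) 0<k)) (cong (_∷ drop 1 (σ*ⁿ 1)) t-zero)
    where
    head∷drop1 : ∀ w → 0 < length w → w ≡ at w 0 ∷ drop 1 w
    head∷drop1 (x ∷ w) _ = refl
  σ*ⁿ-extends (suc j) with X , eq ← σ*ⁿ-extends j = σ* k X , trans (cong (σ* k) eq) (concatMap-++ (σ k) (σ*ⁿ j) X)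

  σ*ⁿ-prefix : ∀ {j j'} → j ≤ j' → ∃ λ X → σ*ⁿ j' ≡ σ*ⁿ j ++ X
  σ*ⁿ-prefix {j} {j'} j≤j' = subst (λ i → ∃ λ X → σ*ⁿ i ≡ σ*ⁿ j ++ X) (m∸n+n≡m j≤j') (extends (j' ∸ j))
    where
    extends : ∀ d → ∃ λ X → σ*ⁿ (d + j) ≡ σ*ⁿ j ++ X
    extends zero    = [] , sym (++-identityʳ (σ*ⁿ j))
    extends (suc d) with X , eq ← extends d | Y , eq′ ← σ*ⁿ-extends (d + j) =
      X ++ Y , trans eq′ (trans (cong (_++ Y) eq) (++-assoc (σ*ⁿ j) X Y))

  at-σ*ⁿ-mono : ∀ {i j j'} → i < k ^ j → j ≤ j' → at (σ*ⁿ j') i ≡ at (σ*ⁿ j) i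
  at-σ*ⁿ-mono {i} {j} i<k^j j≤j' with X , eq ← σ*ⁿ-prefix j≤j' =
    trans (cong (λ w → at w i) eq) (at-++ˡ (σ*ⁿ j) X (subst (i <_) (sym (length-σ*ⁿ j)) i<k^j))

  at-σ*ⁿ : ∀ j {i} → i < k ^ j → at (σ*ⁿ j) i ≡ t k i
  at-σ*ⁿ j {i} i<k^j with ≤-total j (suc i)
  ... | inj₁ j≤1+i = sym (at-σ*ⁿ-mono i<k^j j≤1+i)
  ... | inj₂ 1+i≤j = at-σ*ⁿ-mono (<-trans (n<1+n i) (n<k^n (suc i))) 1+i≤j

  t-σ : ∀ q {l} → l < k → t k (k * q + l) ≡ (t k q + l) % k
  t-σ q {l} l<k = begin
    t k (k * q + l)                  ≡⟨ at-σ*ⁿ (suc q) k*q+l<k^[1+q] ⟨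
    at (σ* k (σ*ⁿ q)) (k * q + l)    ≡⟨ at-σ* k (σ*ⁿ q) (subst (q <_) (sym (length-σ*ⁿ q)) (n<k^n q)) l<k ⟩
    (at (σ*ⁿ q) q + l) % k           ≡⟨ cong (λ x → (x + l) % k) (at-σ*ⁿ q (n<k^n q)) ⟩
    (t k q + l) % k                  ∎
    where
    k*q+l<k^[1+q] : k * q + l < k ^ suc q
    k*q+l<k^[1+q] = <-≤-trans (+-monoʳ-< (k * q) l<k)
      (≤-trans (≤-reflexive (trans (+-comm (k * q) k) (sym (*-suc k q)))) (*-monoʳ-≤ k (n<k^n q)))

  t-< : ∀ i → t k i < k
  t-< i = subst (λ j → t k j < k) (k*[m/k]+m%k≡m i k)
    (subst (_< k) (sym (t-σ (i / k) (m%n<n i k))) (m%n<n _ k))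

  t-small : ∀ {c} → c < k → t k c ≡ c
  t-small {c} c<k = begin
    t k c              ≡⟨ cong (λ i → t k (i + c)) (*-zeroʳ k) ⟨
    t k (k * 0 + c)    ≡⟨ t-σ 0 c<k ⟩
    (t k 0 + c) % k    ≡⟨ cong (λ x → (x + c) % k) t-zero ⟩
    c % k              ≡⟨ m<n⇒m%n≡m c<k ⟩
    c                  ∎

  t-k* : ∀ i → t k (k * i) ≡ t k i
  t-k* i = begin
    t k (k * i)        ≡⟨ cong (t k) (+-identityʳ (k * i)) ⟨
    t k (k * i + 0)    ≡⟨ t-σ i 0<k ⟩
    (t k i + 0) % k    ≡⟨ cong (_% k) (+-identityʳ (t k i)) ⟩
    t k i % k          ≡⟨ m<n⇒m%n≡m (t-< i) ⟩
    t k i              ∎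

  factorAt-t-k : ∀ q → factorAt (t k) (k * q) k ≡ σ k (t k q)
  factorAt-t-k q = trans (applyUpTo-cong-< k (t-σ q)) (sym (map-upTo _ k))

  factorAt-t-k* : ∀ q M → factorAt (t k) (k * q) (k * M) ≡ σ* k (factorAt (t k) q M)
  factorAt-t-k* q zero    = cong (factorAt (t k) (k * q)) (*-zeroʳ k)
  factorAt-t-k* q (suc M) = begin
    factorAt (t k) (k * q) (k * suc M)                        ≡⟨ cong (factorAt (t k) (k * q)) (*-suc k M) ⟩
    factorAt (t k) (k * q) (k + k * M)                        ≡⟨ factorAt-++ (t k) (k * q) k (k * M) ⟩
    factorAt (t k) (k * q) k ++ factorAt (t k) (k * q + k) (k * M)
      ≡⟨ cong₂ _++_ (factorAt-t-k q) (cong (λ i → factorAt (t k) i (k * M)) (trans (+-comm (k * q) k) (sym (*-suc k q)))) ⟩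
    σ k (t k q) ++ factorAt (t k) (k * suc q) (k * M)         ≡⟨ cong (σ k (t k q) ++_) (factorAt-t-k* (suc q) M) ⟩
    σ* k (t k q ∷ factorAt (t k) (suc q) M)                   ≡⟨ cong (σ* k) (factorAt-suc (t k) q M) ⟨
    σ* k (factorAt (t k) q (suc M))                           ∎

  count-factorAt-t-k* : ∀ q M {a} → a < k → count a (factorAt (t k) (k * q) (k * M)) ≡ M
  count-factorAt-t-k* q M {a} a<k =
    trans (cong (count a) (factorAt-t-k* q M)) (trans (count-σ* k (factorAt (t k) q M) a<k) (length-applyUpTo (λ j → t k (q + j)) M))

  EveryPairAtDistance : ℕ → Set
  EveryPairAtDistance d = ∀ {a b} → a < k → b < k → ∃ λ i → t k i ≡ a × t k (i + d) ≡ b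

  -- A pair (a, b) at positions i, i + q reappears as (a + l, b + e) at positions k i + l, k (i + q) + e.
  every-pair-lift : ∀ {q d l e} → l < k → e < k → l + d ≡ k * q + e →
    EveryPairAtDistance q → EveryPairAtDistance d
  every-pair-lift {q} {d} {l} {e} l<k e<k l+d≡ pairs {a} {b} a<k b<k
    with i , ti≡ , ti+q≡ ← pairs (m%n<n (a + (k ∸ l)) k) (m%n<n (b + (k ∸ e)) k) =
    k * i + l , first , second
    where
    first : t k (k * i + l) ≡ a
    first = trans (t-σ i l<k) (trans (cong (λ x → (x + l) % k) ti≡) ([[m+[n∸o]]%n+o]%n≡m (<⇒≤ l<k) a<k))
    position : k * i + l + d ≡ k * (i + q) + e
    position = trans (+-assoc (k * i) l d) (trans (cong (k * i +_) l+d≡) (distrib k i q e))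
      where
      distrib : ∀ k i q e → k * i + (k * q + e) ≡ k * (i + q) + e
      distrib = solve-∀
    second : t k (k * i + l + d) ≡ b
    second = trans (cong (t k) position) (trans (t-σ (i + q) e<k)
      (trans (cong (λ x → (x + e) % k) ti+q≡) ([[m+[n∸o]]%n+o]%n≡m (<⇒≤ e<k) b<k)))

  -- The blocks σ_k(t_i) σ_k(t_{i+1}) meet in the pair (t_i - 1, t_{i+1}), so iterating moves the first letter back.
  pair-at-1-back : ∀ j {b} → b < k → ∃ λ i → t k i ≡ (b + (k ∸ 1) * suc j) % k × t k (i + 1) ≡ b
  pair-at-1-back zero {b} b<k = k * c , first , second
    where
    c : ℕ
    c = (b + (k ∸ 1)) % k
    first : t k (k * c) ≡ (b + (k ∸ 1) * 1) % k
    first = trans (t-k* c) (trans (t-small (m%n<n _ k)) (cong (λ x → (b + x) % k) (sym (*-identityʳ (k ∸ 1)))))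
    second : t k (k * c + 1) ≡ b
    second = trans (t-σ c k≥2) (trans (cong (λ x → (x + 1) % k) (t-small (m%n<n _ k))) ([[m+[n∸o]]%n+o]%n≡m 0<k b<k))
  pair-at-1-back (suc j) {b} b<k with i , ti≡ , ti+1≡ ← pair-at-1-back j b<k = k * i + (k ∸ 1) , first , second
    where
    first : t k (k * i + (k ∸ 1)) ≡ (b + (k ∸ 1) * suc (suc j)) % k
    first = begin
      t k (k * i + (k ∸ 1))                               ≡⟨ t-σ i (∸-monoʳ-< z<s 0<k) ⟩
      (t k i + (k ∸ 1)) % k                               ≡⟨ cong (λ x → (x + (k ∸ 1)) % k) ti≡ ⟩
      ((b + (k ∸ 1) * suc j) % k + (k ∸ 1)) % k           ≡⟨ [m%n+o]%n≡[m+o]%n _ (k ∸ 1) k ⟩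
      (b + (k ∸ 1) * suc j + (k ∸ 1)) % k                 ≡⟨ cong (_% k) (one-more b (k ∸ 1) j) ⟩
      (b + (k ∸ 1) * suc (suc j)) % k                     ∎
      where
      one-more : ∀ b K j → b + K * suc j + K ≡ b + K * suc (suc j)
      one-more = solve-∀
    second : t k (k * i + (k ∸ 1) + 1) ≡ b
    second = trans (cong (t k) (trans (+-assoc (k * i) (k ∸ 1) 1)
      (trans (cong (k * i +_) (m∸n+n≡m 0<k)) (sym (k*[i+1]≡k*i+k i))))) (trans (t-k* (i + 1)) ti+1≡)
      where
      k*[i+1]≡k*i+k : ∀ i → k * (i + 1) ≡ k * i + k
      k*[i+1]≡k*i+k i = trans (*-distribˡ-+ k i 1) (cong (k * i +_) (*-identityʳ k))

  every-pair-at-1 : EveryPairAtDistance 1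
  every-pair-at-1 {a} {b} a<k b<k =
    subst (λ x → ∃ λ i → t k i ≡ x × t k (i + 1) ≡ b) cycle (pair-at-1-back (b + e) b<k)
    where
    e : ℕ
    e = k ∸ suc a
    1+a+e≡k : suc (a + e) ≡ k
    1+a+e≡k = m+[n∸m]≡n a<k
    cycle : (b + (k ∸ 1) * suc (b + e)) % k ≡ a
    cycle = begin
      (b + (k ∸ 1) * suc (b + e)) % k    ≡⟨ cong (λ K → (b + K * suc (b + e)) % k) (cong (_∸ 1) (sym 1+a+e≡k)) ⟩
      (b + (a + e) * suc (b + e)) % k    ≡⟨ cong (_% k) (swap a b e) ⟩
      (a + (b + e) * suc (a + e)) % k    ≡⟨ cong (λ K → (a + (b + e) * K) % k) 1+a+e≡k ⟩
      (a + (b + e) * k) % k              ≡⟨ [m+kn]%n≡m%n a (b + e) k ⟩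
      a % k                              ≡⟨ m<n⇒m%n≡m a<k ⟩
      a                                  ∎
      where
      swap : ∀ a b e → b + (a + e) * suc (b + e) ≡ a + (b + e) * suc (a + e)
      swap = solve-∀

  every-pair : ∀ d → 1 ≤ d → EveryPairAtDistance d
  every-pair = <-rec (λ d → 1 ≤ d → EveryPairAtDistance d) step
    where
    step : ∀ d → (∀ {d'} → d' < d → 1 ≤ d' → EveryPairAtDistance d') → 1 ≤ d → EveryPairAtDistance d
    step (suc d) rec _ with suc d ≤? k
    ... | yes d<k = every-pair-lift (∸-monoʳ-< z<s 0<k) d<k k∸1+[1+d]≡k*1+d every-pair-at-1
      where
      k∸1+[1+d]≡k*1+d : k ∸ 1 + suc d ≡ k * 1 + d
      k∸1+[1+d]≡k*1+d = trans (+-suc (k ∸ 1) d) (trans (cong (_+ d) (m+[n∸m]≡n 0<k)) (cong (_+ d) (sym (*-identityʳ k))))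
    ... | no d≮k = every-pair-lift 0<k (m%n<n (suc d) k) (sym (k*[m/k]+m%k≡m (suc d) k))
      (rec (m/n<m (suc d) k k≥2) (m≥n⇒m/n>0 (<⇒≤ (≰⇒> d≮k))))

  factorAt-t-split : ∀ q M {s} L → s ≤ k →
    factorAt (t k) (k * q + s) ((k ∸ s) + (k * M + L)) ≡
      factorAt (t k) (k * q + s) (k ∸ s) ++ factorAt (t k) (k * suc q) (k * M) ++ factorAt (t k) (k * (q + suc M)) L
  factorAt-t-split q M {s} L s≤k = begin
    factorAt (t k) (k * q + s) ((k ∸ s) + (k * M + L))
      ≡⟨ factorAt-++ (t k) (k * q + s) (k ∸ s) (k * M + L) ⟩
    factorAt (t k) (k * q + s) (k ∸ s) ++ factorAt (t k) (k * q + s + (k ∸ s)) (k * M + L)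
      ≡⟨ cong (λ i → factorAt (t k) (k * q + s) (k ∸ s) ++ factorAt (t k) i (k * M + L)) next-block ⟩
    factorAt (t k) (k * q + s) (k ∸ s) ++ factorAt (t k) (k * suc q) (k * M + L)
      ≡⟨ cong (factorAt (t k) (k * q + s) (k ∸ s) ++_) (factorAt-++ (t k) (k * suc q) (k * M) L) ⟩
    factorAt (t k) (k * q + s) (k ∸ s) ++ factorAt (t k) (k * suc q) (k * M) ++ factorAt (t k) (k * suc q + k * M) L
      ≡⟨ cong (λ i → factorAt (t k) (k * q + s) (k ∸ s) ++ factorAt (t k) (k * suc q) (k * M) ++ factorAt (t k) i L) last-block ⟩
    factorAt (t k) (k * q + s) (k ∸ s) ++ factorAt (t k) (k * suc q) (k * M) ++ factorAt (t k) (k * (q + suc M)) L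
      ∎
    where
    next-block : k * q + s + (k ∸ s) ≡ k * suc q
    next-block = trans (+-assoc (k * q) s (k ∸ s))
      (trans (cong (k * q +_) (m+[n∸m]≡n s≤k)) (trans (+-comm (k * q) k) (sym (*-suc k q))))
    last-block : k * suc q + k * M ≡ k * (q + suc M)
    last-block = trans (sym (*-distribˡ-+ k (suc q) M)) (cong (k *_) (sym (+-suc q M)))

  take-drop-window : ∀ q q' {s L} → s ≤ k → L ≤ k →
    take ((k ∸ s) + L) (drop s (window k (t k q) (t k q'))) ≡
      factorAt (t k) (k * q + s) (k ∸ s) ++ factorAt (t k) (k * q') L
  take-drop-window q q' {s} {L} s≤k L≤k = begin
    take ((k ∸ s) + L) (drop s w)
      ≡⟨ take-drop-at w s ((k ∸ s) + L) in-window ⟩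
    applyUpTo (λ j → at w (s + j)) ((k ∸ s) + L)
      ≡⟨ applyUpTo-++ (λ j → at w (s + j)) (k ∸ s) L ⟩
    applyUpTo (λ j → at w (s + j)) (k ∸ s) ++ applyUpTo (λ j → at w (s + ((k ∸ s) + j))) L
      ≡⟨ cong₂ _++_ (applyUpTo-cong-< (k ∸ s) left) (applyUpTo-cong-< L right) ⟩
    factorAt (t k) (k * q + s) (k ∸ s) ++ factorAt (t k) (k * q') L
      ∎
    where
    w : Word
    w = window k (t k q) (t k q')
    in-window : s + ((k ∸ s) + L) ≤ length w
    in-window = ≤-trans (≤-reflexive (trans (sym (+-assoc s (k ∸ s) L)) (cong (_+ L) (m+[n∸m]≡n s≤k))))
      (≤-trans (+-monoʳ-≤ k L≤k) (≤-reflexive (trans (cong (k +_) (sym (*-identityʳ k))) (trans (sym (*-suc k 1)) (sym (length-window k (t k q) (t k q')))))))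
    left : ∀ {j} → j < k ∸ s → at w (s + j) ≡ t k (k * q + s + j)
    left {j} j<k∸s = begin
      at w (s + j)              ≡⟨ at-window-left k (t k q) (t k q') s+j<k ⟩
      (t k q + (s + j)) % k     ≡⟨ t-σ q s+j<k ⟨
      t k (k * q + (s + j))     ≡⟨ cong (t k) (+-assoc (k * q) s j) ⟨
      t k (k * q + s + j)       ∎
      where
      s+j<k : s + j < k
      s+j<k = <-≤-trans (+-monoʳ-< s j<k∸s) (≤-reflexive (m+[n∸m]≡n s≤k))
    right : ∀ {j} → j < L → at w (s + ((k ∸ s) + j)) ≡ t k (k * q' + j)
    right {j} j<L = begin
      at w (s + ((k ∸ s) + j))  ≡⟨ cong (at w) (trans (sym (+-assoc s (k ∸ s) j)) (cong (_+ j) (m+[n∸m]≡n s≤k))) ⟩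
      at w (k + j)              ≡⟨ at-window-right k (t k q) (t k q') (<-≤-trans j<L L≤k) ⟩
      (t k q' + j) % k          ≡⟨ t-σ q' (<-≤-trans j<L L≤k) ⟨
      t k (k * q' + j)          ∎

  count-factorAt-t : ∀ q M {s L a} → s ≤ k → L ≤ k → a < k →
    count a (factorAt (t k) (k * q + s) ((k ∸ s) + (k * M + L))) ≡
      M + count a (take ((k ∸ s) + L) (drop s (window k (t k q) (t k (q + suc M)))))
  count-factorAt-t q M {s} {L} {a} s≤k L≤k a<k = begin
    count a (factorAt (t k) (k * q + s) ((k ∸ s) + (k * M + L)))   ≡⟨ cong (count a) (factorAt-t-split q M L s≤k) ⟩
    count a (head ++ blocks ++ tail)                                ≡⟨ count-++ a head (blocks ++ tail) ⟩
    count a head + count a (blocks ++ tail)                         ≡⟨ cong (count a head +_) (count-++ a blocks tail) ⟩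
    count a head + (count a blocks + count a tail)                  ≡⟨ cong (λ x → count a head + (x + count a tail)) (count-factorAt-t-k* (suc q) M a<k) ⟩
    count a head + (M + count a tail)                               ≡⟨ x∙yz≈y∙xz (count a head) M (count a tail) ⟩
    M + (count a head + count a tail)                               ≡⟨ cong (M +_) (count-++ a head tail) ⟨
    M + count a (head ++ tail)                                      ≡⟨ cong (λ w → M + count a w) (take-drop-window q (q + suc M) s≤k L≤k) ⟨
    M + count a (take ((k ∸ s) + L) (drop s (window k (t k q) (t k (q + suc M)))))  ∎
    where
    head blocks tail : Word
    head = factorAt (t k) (k * q + s) (k ∸ s)
    blocks = factorAt (t k) (k * suc q) (k * M)
    tail = factorAt (t k) (k * (q + suc M)) L

  ψ-factorAt-t-S : ∀ q m' {s r} → s + r ≤ k →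
    ψ k (factorAt (t k) (k * q + s) (k * suc m' + r)) ≡
      map (m' +_) (ψ k (take (r + k) (drop s (window k (t k q) (t k (q + suc m'))))))
  ψ-factorAt-t-S q m' {s} {r} s+r≤k =
    ψ-shift k m' (factorAt (t k) (k * q + s) (k * suc m' + r)) (take (r + k) (drop s w)) λ {a} a<k → begin
    count a (factorAt (t k) (k * q + s) (k * suc m' + r))
      ≡⟨ cong (λ n → count a (factorAt (t k) (k * q + s) n)) length≡ ⟨
    count a (factorAt (t k) (k * q + s) ((k ∸ s) + (k * m' + (s + r))))
      ≡⟨ count-factorAt-t q m' s≤k s+r≤k a<k ⟩
    m' + count a (take ((k ∸ s) + (s + r)) (drop s w))
      ≡⟨ cong (λ ℓ → m' + count a (take ℓ (drop s w))) (trans ([n∸m]+[m+o]≡n+o r s≤k) (+-comm k r)) ⟩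
    m' + count a (take (r + k) (drop s w))
      ∎
    where
    w : Word
    w = window k (t k q) (t k (q + suc m'))
    s≤k : s ≤ k
    s≤k = ≤-trans (m≤m+n s r) s+r≤k
    length≡ : (k ∸ s) + (k * m' + (s + r)) ≡ k * suc m' + r
    length≡ = begin
      (k ∸ s) + (k * m' + (s + r))   ≡⟨ cong ((k ∸ s) +_) (x∙yz≈y∙xz (k * m') s r) ⟩
      (k ∸ s) + (s + (k * m' + r))   ≡⟨ [n∸m]+[m+o]≡n+o (k * m' + r) s≤k ⟩
      k + (k * m' + r)               ≡⟨ +-assoc k (k * m') r ⟨
      k + k * m' + r                 ≡⟨ cong (_+ r) (*-suc k m') ⟨
      k * suc m' + r                 ∎

  ψ-factorAt-t-G : ∀ q m' {s r} → s < k → r < k → k < s + r →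
    ψ k (factorAt (t k) (k * q + s) (k * suc m' + r)) ≡
      map (m' +_) (𝕀 k ⊕ ψ k (take r (drop s (window k (t k q) (t k (q + suc (suc m')))))))
  ψ-factorAt-t-G q m' {s} {r} s<k r<k k<s+r =
    ψ-shift-𝕀 k m' (factorAt (t k) (k * q + s) (k * suc m' + r)) (take r (drop s w)) λ {a} a<k → begin
    count a (factorAt (t k) (k * q + s) (k * suc m' + r))
      ≡⟨ cong (λ n → count a (factorAt (t k) (k * q + s) n)) length≡ ⟨
    count a (factorAt (t k) (k * q + s) ((k ∸ s) + (k * suc m' + (s + r ∸ k))))
      ≡⟨ count-factorAt-t q (suc m') (<⇒≤ s<k) tail≤k a<k ⟩
    suc m' + count a (take ((k ∸ s) + (s + r ∸ k)) (drop s w))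
      ≡⟨ cong (λ ℓ → suc m' + count a (take ℓ (drop s w))) chunk≡r ⟩
    suc m' + count a (take r (drop s w))
      ≡⟨ +-suc m' _ ⟨
    m' + suc (count a (take r (drop s w)))
      ∎
    where
    w : Word
    w = window k (t k q) (t k (q + suc (suc m')))
    chunk≡r : (k ∸ s) + (s + r ∸ k) ≡ r
    chunk≡r = [n∸m]+[m+o∸n]≡o (<⇒≤ s<k) (<⇒≤ k<s+r)
    length≡ : (k ∸ s) + (k * suc m' + (s + r ∸ k)) ≡ k * suc m' + r
    length≡ = trans (x∙yz≈y∙xz (k ∸ s) (k * suc m') _) (cong (k * suc m' +_) chunk≡r)
    tail≤k : s + r ∸ k ≤ k
    tail≤k = ≤-trans (∸-monoˡ-≤ k (+-monoʳ-≤ s (<⇒≤ r<k))) (≤-trans (≤-reflexive (m+n∸n≡m s k)) (<⇒≤ s<k))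

  InS⇔ : ∀ m r u → InS k m r u ⇔
    (∃₂ λ q s → s + r ≤ k × u ≡ take (r + k) (drop s (window k (t k q) (t k (q + m)))))
  InS⇔ m r u = mk⇔
    (λ (q , s , in-window , u≡) → q , s , +-cancelʳ-≤ k (s + r) k (≤-trans (≤-reflexive (+-assoc s r k))
      (≤-trans in-window (≤-reflexive (trans (length-window k _ _) (sym (m+m≡m*2 k)))))) , u≡)
    (λ (q , s , s+r≤k , u≡) → q , s , ≤-trans (≤-reflexive (sym (+-assoc s r k)))
      (≤-trans (+-monoˡ-≤ k s+r≤k) (≤-reflexive (trans (m+m≡m*2 k) (sym (length-window k _ _))))) , u≡)

  InG⇔ : ∀ m {r} → 2 ≤ r → r < k → ∀ v → InG k m r v ⇔
    (∃₂ λ q s → s < k × k < s + r × v ≡ take r (drop s (window k (t k q) (t k (q + suc m)))))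
  InG⇔ m {r} 2≤r r<k v = mk⇔
    (λ (q , in-slice) → q , Equivalence.to (straddle q) in-slice)
    (λ (q , straddles) → q , Equivalence.from (straddle q) straddles)
    where
    straddle : ∀ q → InFactors (slice (k ∸ r + 2) (k + r ∸ 1) (window k (t k q) (t k (q + suc m)))) r v ⇔
      (∃ λ s → s < k × k < s + r × v ≡ take r (drop s (window k (t k q) (t k (q + suc m)))))
    straddle q = InFactors-straddle⇔ (window k (t k q) (t k (q + suc m))) v 2≤r r<k (length-window k _ _)

  ψ-factorAt-t∈S⊎G : ∀ m' {r} → r < k → ∀ q {s} → s < k → ∃ λ y →
    (PsiS k (suc m') r y ⊎ (2 ≤ r × PsiG k (suc m') r y)) ×
    ψ k (factorAt (t k) (k * q + s) (k * suc m' + r)) ≡ map (m' +_) y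
  ψ-factorAt-t∈S⊎G m' {r} r<k q {s} s<k with s + r ≤? k
  ... | yes s+r≤k = ψ k u , inj₁ (u , Equivalence.from (InS⇔ (suc m') r u) (q , s , s+r≤k , refl) , refl) ,
    ψ-factorAt-t-S q m' s+r≤k
    where
    u : Word
    u = take (r + k) (drop s (window k (t k q) (t k (q + suc m'))))
  ... | no s+r≰k = 𝕀 k ⊕ ψ k v , inj₂ (2≤r , v , Equivalence.from (InG⇔ (suc m') 2≤r r<k v) (q , s , s<k , k<s+r , refl) , refl) ,
    ψ-factorAt-t-G q m' s<k r<k k<s+r
    where
    v : Word
    v = take r (drop s (window k (t k q) (t k (q + suc (suc m')))))
    k<s+r : k < s + r
    k<s+r = ≰⇒> s+r≰k
    2≤r : 2 ≤ r
    2≤r = +-cancelʳ-≤ s 2 r (≤-trans (s≤s s<k) (≤-trans k<s+r (≤-reflexive (+-comm s r))))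

  AbVecs→ : ∀ m' {r p} → r < k → AbVecs k (k * suc m' + r) p → ∃ λ y →
    (PsiS k (suc m') r y ⊎ (2 ≤ r × PsiG k (suc m') r y)) × p ≡ map (m' +_) y
  AbVecs→ m' {r} r<k (v , (i , v≡) , ψv≡p) with y , in-S-or-G , ψ≡ ← ψ-factorAt-t∈S⊎G m' r<k (i / k) (m%n<n i k) =
    y , in-S-or-G , trans (sym ψv≡p) (trans (cong (ψ k) (trans v≡ i≡)) ψ≡)
    where
    i≡ : factorAt (t k) i (k * suc m' + r) ≡ factorAt (t k) (k * (i / k) + i % k) (k * suc m' + r)
    i≡ = cong (λ j → factorAt (t k) j (k * suc m' + r)) (sym (k*[m/k]+m%k≡m i k))

  PsiS→AbVecs : ∀ m' {r y} → PsiS k (suc m') r y → AbVecs k (k * suc m' + r) (map (m' +_) y)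
  PsiS→AbVecs m' {r} (u , in-S , ψu≡y) with q , s , s+r≤k , u≡ ← Equivalence.to (InS⇔ (suc m') r u) in-S =
    factorAt (t k) (k * q + s) (k * suc m' + r) , (k * q + s , refl) ,
    trans (ψ-factorAt-t-S q m' s+r≤k) (cong (map (m' +_)) (trans (cong (ψ k) (sym u≡)) ψu≡y))

  PsiG→AbVecs : ∀ m' {r y} → 2 ≤ r → r < k → PsiG k (suc m') r y → AbVecs k (k * suc m' + r) (map (m' +_) y)
  PsiG→AbVecs m' {r} 2≤r r<k (v , in-G , 𝕀⊕ψv≡y) with q , s , s<k , k<s+r , v≡ ← Equivalence.to (InG⇔ (suc m') 2≤r r<k v) in-G =
    factorAt (t k) (k * q + s) (k * suc m' + r) , (k * q + s , refl) ,
    trans (ψ-factorAt-t-G q m' s<k r<k k<s+r) (cong (map (m' +_)) (trans (cong (λ v → 𝕀 k ⊕ ψ k v) (sym v≡)) 𝕀⊕ψv≡y))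

  AbVecs⇔PsiS : ∀ m' {r} → r < k → r ≤ 1 → ∀ p →
    AbVecs k (k * suc m' + r) p ⇔ (∃ λ y → PsiS k (suc m') r y × p ≡ map (m' +_) y)
  AbVecs⇔PsiS m' r<k r≤1 p = mk⇔ to λ { (y , in-S , refl) → PsiS→AbVecs m' in-S }
    where
    to : AbVecs k (k * suc m' + _) p → ∃ λ y → PsiS k (suc m') _ y × p ≡ map (m' +_) y
    to abv with AbVecs→ m' r<k abv
    ... | y , inj₁ in-S , p≡ = y , in-S , p≡
    ... | y , inj₂ (2≤r , _) , _ = contradiction (≤-trans 2≤r r≤1) λ { (s≤s ()) }

  AbVecs⇔PsiSG : ∀ m' {r} → r < k → 2 ≤ r → ∀ p →
    AbVecs k (k * suc m' + r) p ⇔ (∃ λ y → PsiSG k (suc m') r y × p ≡ map (m' +_) y)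
  AbVecs⇔PsiSG m' r<k 2≤r p = mk⇔ to from
    where
    to : AbVecs k (k * suc m' + _) p → ∃ λ y → PsiSG k (suc m') _ y × p ≡ map (m' +_) y
    to abv with AbVecs→ m' r<k abv
    ... | y , inj₁ in-S , p≡ = y , inj₁ in-S , p≡
    ... | y , inj₂ (_ , in-G) , p≡ = y , inj₂ in-G , p≡
    from : (∃ λ y → PsiSG k (suc m') _ y × p ≡ map (m' +_) y) → AbVecs k (k * suc m' + _) p
    from (y , inj₁ in-S , refl) = PsiS→AbVecs m' in-S
    from (y , inj₂ in-G , refl) = PsiG→AbVecs m' 2≤r r<k in-G

  ∈-overPairs-factors⇔ : ∀ {d ℓ} → 1 ≤ d → (g : ℕ → ℕ → Word) (f : Word → List ℕ) → ∀ p →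
    p ∈ overPairs k (λ a b → map f (factors (g a b) ℓ)) ⇔
      (∃ λ u → (∃ λ i → InFactors (g (t k i) (t k (i + d))) ℓ u) × f u ≡ p)
  ∈-overPairs-factors⇔ {d} {ℓ} 1≤d g f p = mk⇔ to from
    where
    to : p ∈ overPairs k (λ a b → map f (factors (g a b) ℓ)) →
      ∃ λ u → (∃ λ i → InFactors (g (t k i) (t k (i + d))) ℓ u) × f u ≡ p
    to p∈ with a , b , a<k , b<k , p∈′ ← Equivalence.to (∈-overPairs⇔ k _ p) p∈
          with u , u∈ , p≡fu ← ∈-map⁻ f p∈′
          with i , ti≡a , ti+d≡b ← every-pair d 1≤d a<k b<k =
      u , (i , subst₂ (λ a b → InFactors (g a b) ℓ u) (sym ti≡a) (sym ti+d≡b) (Equivalence.to (∈-factors⇔ _ ℓ u) u∈)) ,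
      sym p≡fu
    from : (∃ λ u → (∃ λ i → InFactors (g (t k i) (t k (i + d))) ℓ u) × f u ≡ p) →
      p ∈ overPairs k (λ a b → map f (factors (g a b) ℓ))
    from (u , (i , in-factors) , fu≡p) = Equivalence.from (∈-overPairs⇔ k _ p)
      (t k i , t k (i + d) , t-< i , t-< (i + d) ,
       subst (_∈ _) fu≡p (∈-map⁺ f (Equivalence.from (∈-factors⇔ _ ℓ u) in-factors)))

lemma1 : (k : ℕ) → .{{_ : NonZero k}} → 2 ≤ k →
    (n m r : ℕ) → k ≤ n → 1 ≤ m → r < k → n ≡ k * m + r →
    (r ≤ 1 → ∃ λ c → HasCard (AbVecs k n) c × HasCard (PsiS k m r) c) ×
    (2 ≤ r → ∃ λ c → HasCard (AbVecs k n) c × HasCard (PsiSG k m r) c)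
-- The hypothesis k ≤ n is implied by 1 ≤ m.
lemma1 k k≥2 n (suc m') r _ (s≤s z≤n) r<k refl =
  (λ r≤1 → _ , HasCard-image shift shift-injective (AbVecs⇔PsiS k k≥2 m' r<k r≤1) card-S , card-S) ,
  (λ 2≤r → _ , HasCard-image shift shift-injective (AbVecs⇔PsiSG k k≥2 m' r<k 2≤r) card-SG , card-SG)
  where
  shift : List ℕ → List ℕ
  shift = map (m' +_)
  shift-injective : ∀ {x y} → shift x ≡ shift y → x ≡ y
  shift-injective = map-injective (+-cancelˡ-≡ m' _ _)
  S-list : List (List ℕ)
  S-list = overPairs k (λ a b → map (ψ k) (factors (window k a b) (r + k)))
  G-list : List (List ℕ)
  G-list = overPairs k (λ a b → map (λ v → 𝕀 k ⊕ ψ k v) (factors (slice (k ∸ r + 2) (k + r ∸ 1) (window k a b)) r))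
  S-list⇔ : ∀ p → p ∈ S-list ⇔ PsiS k (suc m') r p
  S-list⇔ = ∈-overPairs-factors⇔ k k≥2 (s≤s z≤n) (window k) (ψ k)
  G-list⇔ : ∀ p → p ∈ G-list ⇔ PsiG k (suc m') r p
  G-list⇔ = ∈-overPairs-factors⇔ k k≥2 (s≤s z≤n) (λ a b → slice (k ∸ r + 2) (k + r ∸ 1) (window k a b)) (λ v → 𝕀 k ⊕ ψ k v)
  card-S : HasCard (PsiS k (suc m') r) _
  card-S = HasCard-deduplicate S-list S-list⇔
  card-SG : HasCard (PsiSG k (suc m') r) _
  card-SG = HasCard-deduplicate (S-list ++ G-list) (∈-++⇔⊎ S-list G-list S-list⇔ G-list⇔)
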